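{- Let $B$ and $C$ be odd positive integers with $\gcd(B,C)=1$. Then the Diophantine equation $x^2+y^{2B} =z^{2C}$ has infinitely many solutions $(x,y,z)$ in integers. -}

module Defs where

open import Data.Nat using (ℕ; _+_; _*_)
open import Data.Integer as ℤ using (ℤ; +_; _<_)
open import Data.Product using (∃; _×_)
open import Relation.Binary.PropositionalEquality using (_≡_)

Odd : ℕ → Set
Odd n = ∃ λ k → n ≡ 2 * k + 1

IsSolution : ℕ → ℕ → ℤ × ℤ × ℤ → Set
IsSolution B C (x Data.Product., y Data.Product., z) =
  (+ 0 < x) × (+ 0 < y) × (+ 0 < z) ×
  (x ℤ.^ 2 ℤ.+ y ℤ.^ (2 * B) ≡ z ℤ.^ (2 * C))

{-# OPTIONS --safe #-}
module Submission where

-- Scale the Pythagorean triple 3² + 4² = 5² by t = 2^α · 5^β chosen so that 4t = y^B and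
-- 5t = z^C; then x = 3t gives x² + y^(2B) = z^(2C).  Comparing exponents of 2 and 5, this asks
-- for α ≡ -2 (mod B), α ≡ 0 (mod C), β ≡ 0 (mod B) and β ≡ -1 (mod C), which Bézout's identity
-- for the coprime B and C solves, with α free to move along the multiples of B·C.  Oddness of
-- B and C is only used to know that they are positive.

open import Defs
open import Data.Nat using (ℕ; zero; suc; _+_; _*_; _^_; _<_; NonZero; >-nonZero)
open import Data.Nat.Properties
open import Algebra.Properties.CommutativeSemigroup *-commutativeSemigroup
  using (x∙yz≈y∙xz) renaming (interchange to *-interchange)
open import Data.Nat.Coprimality using (Coprime; coprime-Bézout) renaming (sym to Coprime-sym)
open import Data.Nat.GCD using (module Bézout)
open import Data.Nat.Solver using (module +-*-Solver)
open import Data.Nat.Tactic.RingSolver using (solve)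
open import Data.Integer as ℤ using (ℤ; +_; +<+)
import Data.Integer.Properties as ℤP
open import Data.List using ([]; _∷_)
open import Data.Product using (Σ; ∃₂; _×_; _,_; proj₁; proj₂)
open import Function using (_∘_)
open import Function.Definitions using (Injective)
open import Relation.Binary.Definitions using (tri<; tri≈; tri>)
open import Relation.Binary.PropositionalEquality
  using (_≡_; refl; sym; trans; cong; cong₂; module ≡-Reasoning)
open import Relation.Nullary using (contradiction)

open ≡-Reasoning

^-distribʳ-* : ∀ m n o → (m * n) ^ o ≡ m ^ o * n ^ o
^-distribʳ-* m n zero    = refl
^-distribʳ-* m n (suc o) =
  trans (cong (m * n *_) (^-distribʳ-* m n o)) (*-interchange m n (m ^ o) (n ^ o))

^-injectiveʳ : ∀ m → 1 < m → Injective _≡_ _≡_ (m ^_)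
^-injectiveʳ m 1<m {a} {b} eq with <-cmp a b
... | tri< a<b _ _ = contradiction eq (<⇒≢ (^-monoʳ-< m 1<m a<b))
... | tri≈ _ a≡b _ = a≡b
... | tri> _ _ b<a = contradiction (sym eq) (<⇒≢ (^-monoʳ-< m 1<m b<a))

pos-^ : ∀ m n → (+ m) ℤ.^ n ≡ + (m ^ n)
pos-^ m zero    = refl
pos-^ m (suc n) = trans (cong (+ m ℤ.*_) (pos-^ m n)) (sym (ℤP.pos-* m (m ^ n)))

coprime⇒1+x*a≡y*b : ∀ {a b} .{{_ : NonZero b}} → Coprime a b → ∃₂ λ x y → 1 + x * a ≡ y * b
coprime⇒1+x*a≡y*b {a} {b@(suc c)} coprime with coprime-Bézout coprime
... | Bézout.-+ x y eq = x , y , eq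
... | Bézout.+- x y eq = c * x , 1 + c * y , (begin
  1 + c * x * a       ≡⟨ cong suc (*-assoc c x a) ⟩
  1 + c * (x * a)     ≡⟨ cong (λ v → 1 + c * v) eq ⟨
  1 + c * (1 + y * b) ≡⟨ solve (c ∷ y ∷ []) ⟩
  (1 + c * y) * b     ∎)

coprime⇒r+x*a≡y*b : ∀ {a b} .{{_ : NonZero b}} → Coprime a b →
                    ∀ r → ∃₂ λ x y → r + x * a ≡ y * b
coprime⇒r+x*a≡y*b {a} {b} coprime r with coprime⇒1+x*a≡y*b coprime
... | x , y , eq = r * x , r * y , (begin
  r + r * x * a   ≡⟨ solve (r ∷ x ∷ a ∷ []) ⟩
  r * (1 + x * a) ≡⟨ cong (r *_) eq ⟩
  r * (y * b)     ≡⟨ *-assoc r y b ⟨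
  r * y * b       ∎)

^[2*n]≡[^n]^2 : ∀ m n → m ^ (2 * n) ≡ (m ^ n) ^ 2
^[2*n]≡[^n]^2 m n = trans (cong (m ^_) (*-comm 2 n)) (sym (^-*-assoc m n 2))

-- Data.Nat.Tactic.RingSolver fails on goals containing _^_, hence the non-reflective solver.
3²+4²≡5² : ∀ t → (3 * t) ^ 2 + (4 * t) ^ 2 ≡ (5 * t) ^ 2
3²+4²≡5² = +-*-Solver.solve 1
  (λ t → (con 3 :* t) :^ 2 :+ (con 4 :* t) :^ 2 := (con 5 :* t) :^ 2) refl
  where open +-*-Solver using (con; _:+_; _:*_; _:^_; _:=_)

[3t]²+y^[2B]≡z^[2C] : ∀ {B C t y z} → y ^ B ≡ 4 * t → z ^ C ≡ 5 * t →
                               (3 * t) ^ 2 + y ^ (2 * B) ≡ z ^ (2 * C)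
[3t]²+y^[2B]≡z^[2C] {B} {C} {t} {y} {z} y^B≡4t z^C≡5t = begin
  (3 * t) ^ 2 + y ^ (2 * B)   ≡⟨ cong (λ v → (3 * t) ^ 2 + v) (^[2*n]≡[^n]^2 y B) ⟩
  (3 * t) ^ 2 + (y ^ B) ^ 2   ≡⟨ cong (λ v → (3 * t) ^ 2 + v ^ 2) y^B≡4t ⟩
  (3 * t) ^ 2 + (4 * t) ^ 2   ≡⟨ 3²+4²≡5² t ⟩
  (5 * t) ^ 2                 ≡⟨ cong (_^ 2) z^C≡5t ⟨
  (z ^ C) ^ 2                 ≡⟨ ^[2*n]≡[^n]^2 z C ⟨
  z ^ (2 * C)                 ∎

ℕ-solution⇒IsSolution : ∀ {B C x y z} → 0 < x → 0 < y → 0 < z →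
                        x ^ 2 + y ^ (2 * B) ≡ z ^ (2 * C) → IsSolution B C (+ x , + y , + z)
ℕ-solution⇒IsSolution {B} {C} {x} {y} {z} 0<x 0<y 0<z eq = +<+ 0<x , +<+ 0<y , +<+ 0<z , (begin
  (+ x) ℤ.^ 2 ℤ.+ (+ y) ℤ.^ (2 * B) ≡⟨ cong₂ ℤ._+_ (pos-^ x 2) (pos-^ y (2 * B)) ⟩
  + (x ^ 2 + y ^ (2 * B))           ≡⟨ cong +_ eq ⟩
  + (z ^ (2 * C))                   ≡⟨ pos-^ z (2 * C) ⟨
  (+ z) ℤ.^ (2 * C)                 ∎)

2^_·5^_ : ℕ → ℕ → ℕ
2^ u ·5^ v = 2 ^ u * 5 ^ v

2^·5^>0 : ∀ u v → 0 < 2^ u ·5^ v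
2^·5^>0 u v = *-mono-< (m^n>0 2 u) (m^n>0 5 v)

2^·5^-^ : ∀ u v e → (2^ u ·5^ v) ^ e ≡ 2^ (u * e) ·5^ (v * e)
2^·5^-^ u v e =
  trans (^-distribʳ-* (2 ^ u) (5 ^ v) e) (cong₂ _*_ (^-*-assoc 2 u e) (^-*-assoc 5 v e))

4*2^·5^ : ∀ u v → 4 * 2^ u ·5^ v ≡ 2^ (2 + u) ·5^ v
4*2^·5^ u v = trans (sym (*-assoc 4 (2 ^ u) (5 ^ v))) (cong (_* 5 ^ v) (*-assoc 2 2 (2 ^ u)))

5*2^·5^ : ∀ u v → 5 * 2^ u ·5^ v ≡ 2^ u ·5^ (1 + v)
5*2^·5^ u v = x∙yz≈y∙xz 5 (2 ^ u) (5 ^ v)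

2^·5^-injectiveˡ : ∀ {u u′} v → 2^ u ·5^ v ≡ 2^ u′ ·5^ v → u ≡ u′
2^·5^-injectiveˡ {u} {u′} v eq =
  ^-injectiveʳ 2 (n<1+n 1) (*-cancelʳ-≡ (2 ^ u) (2 ^ u′) (5 ^ v) {{m^n≢0 5 v}} eq)

module SolutionFamilyConstruction (B C k l m j : ℕ)
  (2+k*C≡l*B : 2 + k * C ≡ l * B) (1+m*B≡j*C : 1 + m * B ≡ j * C) where

  t y z : ℕ → ℕ
  t n = 2^ ((k + n * B) * C) ·5^ (m * B)
  y n = 2^ (l + n * C) ·5^ m
  z n = 2^ (k + n * B) ·5^ j

  y^B≡4t : ∀ n → y n ^ B ≡ 4 * t n
  y^B≡4t n = begin
    y n ^ B                              ≡⟨ 2^·5^-^ (l + n * C) m B ⟩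
    2^ ((l + n * C) * B) ·5^ (m * B)     ≡⟨ cong (2^_·5^ (m * B)) exponent ⟩
    2^ (2 + (k + n * B) * C) ·5^ (m * B) ≡⟨ 4*2^·5^ ((k + n * B) * C) (m * B) ⟨
    4 * t n                              ∎
    where
    exponent : (l + n * C) * B ≡ 2 + (k + n * B) * C
    exponent = begin
      (l + n * C) * B       ≡⟨ *-distribʳ-+ B l (n * C) ⟩
      l * B + n * C * B     ≡⟨ cong (_+ n * C * B) 2+k*C≡l*B ⟨
      2 + k * C + n * C * B ≡⟨ solve (k ∷ n ∷ B ∷ C ∷ []) ⟩
      2 + (k + n * B) * C   ∎

  z^C≡5t : ∀ n → z n ^ C ≡ 5 * t n
  z^C≡5t n = begin
    z n ^ C                              ≡⟨ 2^·5^-^ (k + n * B) j C ⟩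
    2^ ((k + n * B) * C) ·5^ (j * C)     ≡⟨ cong (2^ ((k + n * B) * C) ·5^_) 1+m*B≡j*C ⟨
    2^ ((k + n * B) * C) ·5^ (1 + m * B) ≡⟨ 5*2^·5^ ((k + n * B) * C) (m * B) ⟨
    5 * t n                              ∎

  family : ℕ → ℤ × ℤ × ℤ
  family n = + (3 * t n) , + y n , + z n

  family-isSolution : ∀ n → IsSolution B C (family n)
  family-isSolution n =
    ℕ-solution⇒IsSolution {B} {C} (*-monoʳ-< 3 (2^·5^>0 ((k + n * B) * C) (m * B)))
      (2^·5^>0 (l + n * C) m) (2^·5^>0 (k + n * B) j)
      ([3t]²+y^[2B]≡z^[2C] {B} {C} {t n} (y^B≡4t n) (z^C≡5t n))

  family-injective : .{{_ : NonZero C}} → Injective _≡_ _≡_ family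
  family-injective {n} {n′} eq = *-cancelʳ-≡ n n′ C (+-cancelˡ-≡ l _ _ (2^·5^-injectiveˡ m yₙ≡yₙ′))
    where
    yₙ≡yₙ′ : y n ≡ y n′
    yₙ≡yₙ′ = ℤP.+-injective (cong (proj₁ ∘ proj₂) eq)

SolutionFamily : ℕ → ℕ → Set
SolutionFamily B C = Σ (ℕ → ℤ × ℤ × ℤ) λ f → Injective _≡_ _≡_ f × (∀ n → IsSolution B C (f n))

coprime⇒solutionFamily : ∀ B C .{{_ : NonZero B}} .{{_ : NonZero C}} → Coprime B C →
                         SolutionFamily B C
coprime⇒solutionFamily B C coprime
  with coprime⇒r+x*a≡y*b (Coprime-sym coprime) 2 | coprime⇒r+x*a≡y*b coprime 1
... | k , l , 2+k*C≡l*B | m , j , 1+m*B≡j*C =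
  family , family-injective , family-isSolution
  where open SolutionFamilyConstruction B C k l m j 2+k*C≡l*B 1+m*B≡j*C

odd⇒nonZero : ∀ {n} → Odd n → NonZero n
odd⇒nonZero (k , refl) = >-nonZero (m≤n+m 1 (2 * k))

theorem1 : (B C : ℕ) → Odd B → Odd C → Coprime B C →
           Σ (ℕ → ℤ × ℤ × ℤ) λ f → Injective _≡_ _≡_ f × (∀ n → IsSolution B C (f n))
theorem1 B C odd-B odd-C = coprime⇒solutionFamily B C {{odd⇒nonZero odd-B}} {{odd⇒nonZero odd-C}}
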